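{- For $n\ge1$, $$\sum_{\sigma\in\mathfrak S_n}(xy)^{{\rm M}(\sigma)}\Bigl(\frac{x+y}{2}\Bigr)^{n-2{\rm M}(\sigma)-1}\alpha^{{\rm LRmin}(\sigma)-1}\beta^{{\rm RLmin}(\sigma)-1}=\sum_{\sigma\in\mathfrak S_n}x^{{\rm des}(\sigma)}y^{n-{\rm des}(\sigma)-1}\Bigl(\frac{\alpha+\beta}{2}\Bigr)^{{\rm LRmin}(\sigma)+{\rm RLmin}(\sigma)-2}.$$
   Context: $\mathfrak S_n$ is the set of permutations $\sigma=\sigma_1\cdots\sigma_n$ of $[n]$; $x,y,\alpha,\beta$ are indeterminates (or complex numbers). ${\rm M}(\sigma)$ is the number of interior peaks ($1<i<n$, $\sigma_{i-1}<\sigma_i>\sigma_{i+1}$); ${\rm des}(\sigma)$ is the number of $1\le i<n$ with $\sigma_i>\sigma_{i+1}$; ${\rm LRmin}(\sigma)$ (resp. ${\rm RLmin}(\sigma)$) is the number of entries smaller than all entries to their left (resp. right). -}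

module Defs where

open import Data.Nat as ℕ using (ℕ; zero; suc; _∸_; _<ᵇ_)
open import Data.Bool using (Bool; true; false; if_then_else_; _∧_)
open import Data.List using (List; []; _∷_; concatMap; map; foldr; reverse)
open import Data.Rational using (ℚ; 0ℚ; 1ℚ; _+_; _*_)

insertEverywhere : ℕ → List ℕ → List (List ℕ)
insertEverywhere a [] = (a ∷ []) ∷ []
insertEverywhere a (b ∷ bs) = (a ∷ b ∷ bs) ∷ map (b ∷_) (insertEverywhere a bs)

Perms : ℕ → List (List ℕ)
Perms zero = [] ∷ []
Perms (suc n) = concatMap (insertEverywhere (suc n)) (Perms n)

des : List ℕ → ℕ
des [] = 0
des (a ∷ []) = 0
des (a ∷ b ∷ w) = (if b <ᵇ a then 1 else 0) ℕ.+ des (b ∷ w)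

peaks : List ℕ → ℕ
peaks (a ∷ b ∷ c ∷ w) = (if (a <ᵇ b) ∧ (c <ᵇ b) then 1 else 0) ℕ.+ peaks (b ∷ c ∷ w)
peaks _ = 0

lrminFrom : ℕ → List ℕ → ℕ
lrminFrom m [] = 0
lrminFrom m (a ∷ w) = if a <ᵇ m then suc (lrminFrom a w) else lrminFrom m w

LRmin : List ℕ → ℕ
LRmin [] = 0
LRmin (a ∷ w) = suc (lrminFrom a w)

RLmin : List ℕ → ℕ
RLmin w = LRmin (reverse w)

infixr 8 _^_
_^_ : ℚ → ℕ → ℚ
q ^ zero = 1ℚ
q ^ suc k = q * (q ^ k)

sumℚ : List ℚ → ℚ
sumℚ = foldr _+_ 0ℚ

-- Both sides, viewed as functions Fₙ(x, y, α, β), satisfy F₁ = 1 and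
--   Fₙ₊₁ = (x + y)(α + β)/2 · Fₙ + x y (∂ₓ + ∂ᵧ) Fₙ.
-- Inserting n + 1 into a permutation of [n] at the front adds a left-to-right minimum, at the
-- back a right-to-left minimum, and in one of the n − 1 interior slots changes neither; an
-- interior slot keeps the number of descents if it lies inside a descent and the number of peaks
-- if it is next to a peak (des σ, resp. 2 · peaks σ slots) and raises it by one otherwise.
-- The directional derivative is the ε-part of the value at (x + ε, y + ε) over the dual numbers,
-- so the induction runs over all commutative semirings containing ½, and the induction
-- hypothesis is used both over the semiring and over its dual numbers.

module Submission where

open import Level using (0ℓ)
open import Algebra.Bundles using (CommutativeSemiring)
open import Algebra.Core using (Op₂)
open import Algebra.Definitions using (Associative)
open import Algebra.Structures using (IsCommutativeSemiring; IsCommutativeRing; IsSemigroup)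
open import Algebra.Structures.Biased using (IsCommutativeSemiringˡ; isCommutativeMonoidˡ)
open import Data.Bool using (Bool; true; false; _∧_; if_then_else_)
open import Data.Bool.Properties using (T-≡; T-∧; ¬-not; ∧-zeroʳ)
open import Data.Empty using (⊥-elim)
open import Data.List using (List; []; _∷_; _++_; _∷ʳ_; map; foldr; replicate; reverse; length; concatMap)
open import Data.List.Properties
  using (map-++; map-replicate; map-∘; map-cong; length-++; reverse-++; unfold-reverse; ++-assoc;
         ++-identityʳ; reverse-involutive)
open import Data.List.Membership.Propositional using (_∈_)
open import Data.List.Membership.Propositional.Properties using (∈-map⁻; ∈-concat⁻′)
open import Data.List.Relation.Unary.Any using (here; there)
open import Data.List.Relation.Unary.All as All using (All; []; _∷_)
open import Data.List.Relation.Unary.All.Properties using (++⁺; ++⁻; ++⁻ˡ; ++⁻ʳ)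
open import Data.List.Relation.Binary.Permutation.Propositional
  using (_↭_; ↭-refl; ↭-sym; ↭-trans; ↭-reflexive; prep; ↭⇒↭ₛ; module PermutationReasoning)
open import Data.List.Relation.Binary.Permutation.Propositional.Properties
  using (map⁺; shift; All-resp-↭; ↭-reverse)
open import Data.Nat as ℕ using (ℕ; zero; suc; _∸_; _<ᵇ_; _<_; _≤_; z≤n; s≤s)
open import Data.Nat.Properties using (≤-refl)
import Data.Nat.Properties as ℕₚ
open import Data.Product using (_×_; _,_; proj₁; proj₂; ∃-syntax; ∃₂)
open import Function using (_∘_; Equivalence)
open import Relation.Binary.PropositionalEquality

open import Defs using (Perms; insertEverywhere; peaks; des; lrminFrom; LRmin; RLmin)

-- Inserting a letter larger than all others

<ᵇ-true : ∀ {a b} → a < b → (a <ᵇ b) ≡ true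
<ᵇ-true a<b = Equivalence.to T-≡ (ℕₚ.<⇒<ᵇ a<b)

<ᵇ-false : ∀ {a b} → b ≤ a → (a <ᵇ b) ≡ false
<ᵇ-false {a} {b} b≤a = ¬-not (λ a<ᵇb → ℕₚ.≤⇒≯ b≤a (ℕₚ.<ᵇ⇒< a b (Equivalence.from T-≡ a<ᵇb)))

insertBefore : ℕ → List ℕ → List (List ℕ)
insertBefore m []       = []
insertBefore m (d ∷ ds) = (m ∷ d ∷ ds) ∷ map (d ∷_) (insertBefore m ds)

insertEverywhere-split : ∀ m w → insertEverywhere m w ≡ insertBefore m w ++ (w ∷ʳ m) ∷ []
insertEverywhere-split m []       = refl
insertEverywhere-split m (d ∷ ds) = cong ((m ∷ d ∷ ds) ∷_)
  (trans (cong (map (d ∷_)) (insertEverywhere-split m ds)) (map-++ (d ∷_) (insertBefore m ds) _))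

∈-insertBefore⁻ : ∀ {m t} w → t ∈ insertBefore m w →
                  ∃[ u ] ∃[ e ] ∃[ v ] w ≡ u ++ e ∷ v × t ≡ u ++ m ∷ e ∷ v
∈-insertBefore⁻ (d ∷ ds) (here refl) = [] , d , ds , refl , refl
∈-insertBefore⁻ (d ∷ ds) (there t∈) with ∈-map⁻ _ t∈
... | t′ , t′∈ , refl with ∈-insertBefore⁻ ds t′∈
...   | u , e , v , refl , refl = d ∷ u , e , v , refl , refl

Below : ℕ → List ℕ → Set
Below m = All (_< m)

reverse-≢-[] : ∀ {w : List ℕ} → w ≢ [] → reverse w ≢ []
reverse-≢-[] {w} w≢[] eq = w≢[] (trans (sym (reverse-involutive w)) (cong reverse eq))

0<RLmin : ∀ c cs → 0 < RLmin (c ∷ cs)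
0<RLmin c cs with reverse (c ∷ cs) | reverse-≢-[] {c ∷ cs} (λ ())
... | []    | rev≢[] = ⊥-elim (rev≢[] refl)
... | _ ∷ _ | _      = s≤s z≤n

module _ {m : ℕ} where

  lrminFrom-max : ∀ w → Below m w → lrminFrom m w ≡ LRmin w
  lrminFrom-max []      []          = refl
  lrminFrom-max (a ∷ w) (a<m ∷ _)   rewrite <ᵇ-true a<m = refl

  LRmin-max-∷ : ∀ w → Below m w → LRmin (m ∷ w) ≡ suc (LRmin w)
  LRmin-max-∷ w w<m = cong suc (lrminFrom-max w w<m)

  lrminFrom-insert : ∀ {mn} u v → mn < m → Below m u → lrminFrom mn (u ++ m ∷ v) ≡ lrminFrom mn (u ++ v)
  lrminFrom-insert []      v mn<m _ rewrite <ᵇ-false {m} (ℕₚ.<⇒≤ mn<m) = refl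
  lrminFrom-insert {mn} (a ∷ u) v mn<m (a<m ∷ u<m) with a <ᵇ mn
  ... | true  = cong suc (lrminFrom-insert u v a<m u<m)
  ... | false = lrminFrom-insert u v mn<m u<m

  LRmin-insert : ∀ u v → u ≢ [] → Below m u → LRmin (u ++ m ∷ v) ≡ LRmin (u ++ v)
  LRmin-insert []      v u≢[] _           = ⊥-elim (u≢[] refl)
  LRmin-insert (a ∷ u) v _    (a<m ∷ u<m) = cong suc (lrminFrom-insert u v a<m u<m)

  private
    reverse-insert : ∀ u (v : List ℕ) → reverse (u ++ m ∷ v) ≡ reverse v ++ m ∷ reverse u
    reverse-insert u v = begin
      reverse (u ++ m ∷ v)              ≡⟨ reverse-++ u (m ∷ v) ⟩
      reverse (m ∷ v) ++ reverse u      ≡⟨ cong (_++ reverse u) (unfold-reverse m v) ⟩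
      (reverse v ∷ʳ m) ++ reverse u     ≡⟨ ++-assoc (reverse v) (m ∷ []) (reverse u) ⟩
      reverse v ++ m ∷ reverse u        ∎
      where open ≡-Reasoning

    Below-reverse : ∀ {w} → Below m w → Below m (reverse w)
    Below-reverse {w} = All-resp-↭ (↭-sym (↭-reverse w))

  RLmin-insert : ∀ u v → v ≢ [] → Below m v → RLmin (u ++ m ∷ v) ≡ RLmin (u ++ v)
  RLmin-insert u v v≢[] v<m = begin
    LRmin (reverse (u ++ m ∷ v))       ≡⟨ cong LRmin (reverse-insert u v) ⟩
    LRmin (reverse v ++ m ∷ reverse u) ≡⟨ LRmin-insert (reverse v) (reverse u) (reverse-≢-[] v≢[])
                                                       (Below-reverse v<m) ⟩
    LRmin (reverse v ++ reverse u)     ≡⟨ cong LRmin (sym (reverse-++ u v)) ⟩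
    LRmin (reverse (u ++ v))           ∎
    where open ≡-Reasoning

  RLmin-∷ʳ-max : ∀ w → Below m w → RLmin (w ∷ʳ m) ≡ suc (RLmin w)
  RLmin-∷ʳ-max w w<m =
    trans (cong LRmin (reverse-++ w (m ∷ []))) (LRmin-max-∷ (reverse w) (Below-reverse w<m))

  LRmin-∷ʳ-max : ∀ w → w ≢ [] → Below m w → LRmin (w ∷ʳ m) ≡ LRmin w
  LRmin-∷ʳ-max w w≢[] w<m = trans (LRmin-insert w [] w≢[] w<m) (cong LRmin (++-identityʳ w))

  RLmin-max-∷ : ∀ w → w ≢ [] → Below m w → RLmin (m ∷ w) ≡ RLmin w
  RLmin-max-∷ = RLmin-insert []

  interior-minima : ∀ c cs {t} → Below m (c ∷ cs) → t ∈ insertBefore m cs →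
                    LRmin (c ∷ t) ≡ LRmin (c ∷ cs) × RLmin (c ∷ t) ≡ RLmin (c ∷ cs)
  interior-minima c cs c∷cs<m t∈ with u , e , v , refl , refl ← ∈-insertBefore⁻ cs t∈ =
    LRmin-insert (c ∷ u) (e ∷ v) (λ ()) (++⁻ˡ (c ∷ u) c∷cs<m) ,
    RLmin-insert (c ∷ u) (e ∷ v) (λ ()) (++⁻ʳ (c ∷ u) c∷cs<m)

-- The values of a statistic over the interior slots: A slots keep the value k, B raise it.
levels : ℕ → ℕ → ℕ → List ℕ
levels k A B = replicate A k ++ replicate B (suc k)

map-+-levels : ∀ a k A B → map (a ℕ.+_) (levels k A B) ≡ levels (a ℕ.+ k) A B
map-+-levels a k A B = trans (map-++ (a ℕ.+_) (replicate A k) _)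
  (cong₂ _++_ (map-replicate (a ℕ.+_) A k)
              (trans (map-replicate (a ℕ.+_) B (suc k)) (cong (replicate B) (ℕₚ.+-suc a k))))

suc-∷-levels : ∀ k A B → suc k ∷ levels k A B ↭ levels k A (suc B)
suc-∷-levels k A B = ↭-sym (shift (suc k) (replicate A k) (replicate B (suc k)))

bit : Bool → ℕ
bit b = if b then 1 else 0

bit-≤1 : ∀ b → bit b ≤ 1
bit-≤1 true  = ≤-refl
bit-≤1 false = z≤n

des-insertBefore-step : ∀ b D {B n} → b ≤ 1 → D ℕ.+ B ≡ n →
  ∃[ B′ ] b ℕ.+ D ℕ.+ B′ ≡ suc n × suc D ∷ levels (b ℕ.+ D) D B ↭ levels (b ℕ.+ D) (b ℕ.+ D) B′
des-insertBefore-step 0 D {B} z≤n eq = suc B , trans (ℕₚ.+-suc D B) (cong suc eq) , suc-∷-levels D D B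
des-insertBefore-step 1 D {B} _   eq = B , cong suc eq , ↭-refl
des-insertBefore-step (suc (suc _)) D (s≤s ())

peakAt : ℕ → ℕ → List ℕ → ℕ
peakAt a b []      = 0
peakAt a b (c ∷ _) = bit ((a <ᵇ b) ∧ (c <ᵇ b))

peaks-∷-∷ : ∀ a b w → peaks (a ∷ b ∷ w) ≡ peakAt a b w ℕ.+ peaks (b ∷ w)
peaks-∷-∷ a b []      = refl
peaks-∷-∷ a b (c ∷ w) = refl

peakAt-self : ∀ a w → peakAt a a w ≡ 0
peakAt-self a []      = refl
peakAt-self a (_ ∷ _) rewrite <ᵇ-false {a} ≤-refl = refl

peaks-dup : ∀ a w → peaks (a ∷ a ∷ w) ≡ peaks (a ∷ w)
peaks-dup a w = trans (peaks-∷-∷ a a w) (cong (ℕ._+ peaks (a ∷ w)) (peakAt-self a w))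

peakAt-adjacent : ∀ a b c w → peakAt a b (c ∷ w) ℕ.+ peakAt b c w ≤ 1
peakAt-adjacent a b c w with (a <ᵇ b) ∧ (c <ᵇ b) in eq
... | false = peakAt-≤1 w
  where
  peakAt-≤1 : ∀ w → peakAt b c w ≤ 1
  peakAt-≤1 []      = z≤n
  peakAt-≤1 (d ∷ _) = bit-≤1 _
... | true  = s≤s (ℕₚ.≤-reflexive (not-peak w))
  where
  c<b : c < b
  c<b = ℕₚ.<ᵇ⇒< c b (proj₂ (Equivalence.to T-∧ (Equivalence.from T-≡ eq)))
  not-peak : ∀ w → peakAt b c w ≡ 0
  not-peak []      = refl
  not-peak (d ∷ _) rewrite <ᵇ-false {b} {c} (ℕₚ.<⇒≤ c<b) = refl

peaks-insertBefore-step : ∀ π π′ Q {A B n} →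
  π ℕ.+ π′ ≤ 1 → π′ ℕ.+ A ≡ 2 ℕ.* (π′ ℕ.+ Q) → A ℕ.+ B ≡ n → let P = π ℕ.+ (π′ ℕ.+ Q) in
  ∃₂ λ A′ B′ → π ℕ.+ A′ ≡ 2 ℕ.* P × A′ ℕ.+ B′ ≡ suc n × suc Q ∷ levels P A B ↭ levels P A′ B′
peaks-insertBefore-step 0 0 Q {A} {B} _ eA eB =
  A , suc B , eA , trans (ℕₚ.+-suc A B) (cong suc eB) , suc-∷-levels Q A B
peaks-insertBefore-step 0 1 Q {A} {B} _ eA eB = suc A , B , eA , cong suc eB , ↭-refl
peaks-insertBefore-step 1 0 Q {A} {B} _ eA eB =
  suc A , B , trans (cong (suc ∘ suc) eA) (sym (ℕₚ.*-suc 2 Q)) , cong suc eB , ↭-refl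
peaks-insertBefore-step 0 (suc (suc _)) Q (s≤s ())
peaks-insertBefore-step 1 (suc _) Q (s≤s ())
peaks-insertBefore-step (suc (suc _)) _ Q (s≤s ())

module _ {m : ℕ} where

  des-max-∷ : ∀ {c} cs → c < m → des (m ∷ c ∷ cs) ≡ suc (des (c ∷ cs))
  des-max-∷ cs c<m rewrite <ᵇ-true c<m = refl

  des-∷ʳ-max : ∀ w → Below m w → des (w ∷ʳ m) ≡ des w
  des-∷ʳ-max []          _           = refl
  des-∷ʳ-max (a ∷ [])    (a<m ∷ _)   rewrite <ᵇ-false {m} (ℕₚ.<⇒≤ a<m) = refl
  des-∷ʳ-max (a ∷ b ∷ w) (_ ∷ b∷w<m) = cong (bit (b <ᵇ a) ℕ.+_) (des-∷ʳ-max (b ∷ w) b∷w<m)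

  des-around-max : ∀ {c d} ds → c < m → d < m → des (c ∷ m ∷ d ∷ ds) ≡ suc (des (d ∷ ds))
  des-around-max ds c<m d<m rewrite <ᵇ-false {m} (ℕₚ.<⇒≤ c<m) | <ᵇ-true d<m = refl

  des-insertBefore : ∀ c cs → Below m (c ∷ cs) → let D = des (c ∷ cs) in
    ∃[ B ] D ℕ.+ B ≡ length cs × map (λ t → des (c ∷ t)) (insertBefore m cs) ↭ levels D D B
  des-insertBefore c []       _ = 0 , refl , ↭-refl
  des-insertBefore c (d ∷ ds) (c<m ∷ d<m ∷ ds<m)
    with B , eB , perm ← des-insertBefore d ds (d<m ∷ ds<m)
    with B′ , eB′ , perm′ ← des-insertBefore-step (bit (d <ᵇ c)) (des (d ∷ ds)) (bit-≤1 (d <ᵇ c)) eB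
    = B′ , eB′ , (begin
      des (c ∷ m ∷ d ∷ ds) ∷ map (λ t → des (c ∷ t)) (map (d ∷_) I)
        ≡⟨ cong₂ _∷_ (des-around-max ds c<m d<m) (trans (sym (map-∘ I)) (map-∘ I)) ⟩
      suc D′ ∷ map (b ℕ.+_) (map (λ t → des (d ∷ t)) I)
        ↭⟨ prep _ (map⁺ (b ℕ.+_) perm) ⟩
      suc D′ ∷ map (b ℕ.+_) (levels D′ D′ B)
        ≡⟨ cong (suc D′ ∷_) (map-+-levels b D′ D′ B) ⟩
      suc D′ ∷ levels (b ℕ.+ D′) D′ B
        ↭⟨ perm′ ⟩
      levels (b ℕ.+ D′) (b ℕ.+ D′) B′ ∎)
    where
    open PermutationReasoning
    I : List (List ℕ)
    I = insertBefore m ds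
    b D′ : ℕ
    b = bit (d <ᵇ c)
    D′ = des (d ∷ ds)

  peaks-max-∷ : ∀ {c} cs → c < m → peaks (m ∷ c ∷ cs) ≡ peaks (c ∷ cs)
  peaks-max-∷ []      c<m = refl
  peaks-max-∷ (d ∷ _) c<m rewrite <ᵇ-false {m} (ℕₚ.<⇒≤ c<m) = refl

  peaks-∷ʳ-max : ∀ w → Below m w → peaks (w ∷ʳ m) ≡ peaks w
  peaks-∷ʳ-max []              _                 = refl
  peaks-∷ʳ-max (a ∷ [])        _                 = refl
  peaks-∷ʳ-max (a ∷ b ∷ [])    (_ ∷ b<m ∷ _)
    rewrite <ᵇ-false {m} (ℕₚ.<⇒≤ b<m) | ∧-zeroʳ (a <ᵇ b) = refl
  peaks-∷ʳ-max (a ∷ b ∷ c ∷ w) (_ ∷ b∷c∷w<m) =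
    cong (bit ((a <ᵇ b) ∧ (c <ᵇ b)) ℕ.+_) (peaks-∷ʳ-max (b ∷ c ∷ w) b∷c∷w<m)

  peaks-around-max : ∀ b c {d} ds → c < m → d < m → peaks (b ∷ c ∷ m ∷ d ∷ ds) ≡ suc (peaks (d ∷ ds))
  peaks-around-max b c ds c<m d<m
    rewrite <ᵇ-false {m} (ℕₚ.<⇒≤ c<m) | ∧-zeroʳ (b <ᵇ c) | <ᵇ-true c<m | <ᵇ-true d<m =
    cong suc (peaks-max-∷ ds d<m)

  -- The letter b before c is carried along because it decides whether c is a peak.
  peaks-insertBefore : ∀ b c cs → Below m (c ∷ cs) →
    let π = peakAt b c cs ; P = π ℕ.+ peaks (c ∷ cs) in
    ∃₂ λ A B → π ℕ.+ A ≡ 2 ℕ.* P × A ℕ.+ B ≡ length cs ×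
               map (λ t → peaks (b ∷ c ∷ t)) (insertBefore m cs) ↭ levels P A B
  peaks-insertBefore b c []       _ = 0 , 0 , refl , refl , ↭-refl
  peaks-insertBefore b c (d ∷ ds) (c<m ∷ d<m ∷ ds<m)
    rewrite peaks-∷-∷ c d ds
    with A , B , eA , eB , perm ← peaks-insertBefore c d ds (d<m ∷ ds<m)
    with A′ , B′ , eA′ , eB′ , perm′ ← peaks-insertBefore-step (peakAt b c (d ∷ ds)) (peakAt c d ds)
                                         (peaks (d ∷ ds)) (peakAt-adjacent b c d ds) eA eB
    = A′ , B′ , eA′ , eB′ , (begin
      peaks (b ∷ c ∷ m ∷ d ∷ ds) ∷ map (λ t → peaks (b ∷ c ∷ t)) (map (d ∷_) I)
        ≡⟨ cong₂ _∷_ (peaks-around-max b c ds c<m d<m) (trans (sym (map-∘ I)) (map-∘ I)) ⟩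
      suc Q ∷ map (π ℕ.+_) (map (λ t → peaks (c ∷ d ∷ t)) I)
        ↭⟨ prep _ (map⁺ (π ℕ.+_) perm) ⟩
      suc Q ∷ map (π ℕ.+_) (levels (π′ ℕ.+ Q) A B)
        ≡⟨ cong (suc Q ∷_) (map-+-levels π (π′ ℕ.+ Q) A B) ⟩
      suc Q ∷ levels (π ℕ.+ (π′ ℕ.+ Q)) A B
        ↭⟨ perm′ ⟩
      levels (π ℕ.+ (π′ ℕ.+ Q)) A′ B′ ∎)
    where
    open PermutationReasoning
    I : List (List ℕ)
    I = insertBefore m ds
    π π′ Q : ℕ
    π = peakAt b c (d ∷ ds)
    π′ = peakAt c d ds
    Q = peaks (d ∷ ds)

  -- A repeated first letter is never a peak, so c itself can serve as the letter before c.
  peaks-interior : ∀ c cs → Below m (c ∷ cs) → let p = peaks (c ∷ cs) in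
    ∃[ B ] 2 ℕ.* p ℕ.+ B ≡ length cs ×
           map (λ t → peaks (c ∷ t)) (insertBefore m cs) ↭ levels p (2 ℕ.* p) B
  peaks-interior c cs c∷cs<m with A , B , eA , eB , perm ← peaks-insertBefore c c cs c∷cs<m =
    B , trans (cong (ℕ._+ B) (sym A≡2p)) eB ,
    ↭-trans (↭-reflexive (map-cong (λ t → sym (peaks-dup c t)) (insertBefore m cs)))
            (subst₂ (λ P A → map (λ t → peaks (c ∷ c ∷ t)) (insertBefore m cs) ↭ levels P A B)
                    (cong (ℕ._+ p) (peakAt-self c cs)) A≡2p perm)
    where
    p : ℕ
    p = peaks (c ∷ cs)
    A≡2p : A ≡ 2 ℕ.* p
    A≡2p = subst (λ π → π ℕ.+ A ≡ 2 ℕ.* (π ℕ.+ p)) (peakAt-self c cs) eA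

-- Permutations

∈-insertEverywhere⁻ : ∀ {a σ} w → σ ∈ insertEverywhere a w →
                      ∃[ u ] ∃[ v ] w ≡ u ++ v × σ ≡ u ++ a ∷ v
∈-insertEverywhere⁻ []       (here refl) = [] , [] , refl , refl
∈-insertEverywhere⁻ (b ∷ bs) (here refl) = [] , b ∷ bs , refl , refl
∈-insertEverywhere⁻ (b ∷ bs) (there σ∈) with ∈-map⁻ _ σ∈
... | σ′ , σ′∈ , refl with ∈-insertEverywhere⁻ bs σ′∈
...   | u , v , refl , refl = b ∷ u , v , refl , refl

∈-Perms-suc⁻ : ∀ {n σ} → σ ∈ Perms (suc n) → ∃[ τ ] τ ∈ Perms n × σ ∈ insertEverywhere (suc n) τ
∈-Perms-suc⁻ {n} σ∈ with _ , σ∈ws , ws∈ ← ∈-concat⁻′ (map (insertEverywhere (suc n)) (Perms n)) σ∈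
                    with τ , τ∈ , refl ← ∈-map⁻ (insertEverywhere (suc n)) ws∈ = τ , τ∈ , σ∈ws

Perms-below : ∀ n {σ} → σ ∈ Perms n → Below (suc n) σ
Perms-below zero    (here refl) = []
Perms-below (suc n) σ∈ with τ , τ∈ , σ∈′ ← ∈-Perms-suc⁻ {n} σ∈
                       with u , v , refl , refl ← ∈-insertEverywhere⁻ τ σ∈′ =
  let u<n , v<n = ++⁻ u (All.map ℕₚ.m<n⇒m<1+n (Perms-below n τ∈)) in ++⁺ u<n (ℕₚ.n<1+n (suc n) ∷ v<n)

Perms-length : ∀ n {σ} → σ ∈ Perms n → length σ ≡ n
Perms-length zero    (here refl) = refl
Perms-length (suc n) σ∈ with τ , τ∈ , σ∈′ ← ∈-Perms-suc⁻ {n} σ∈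
                        with u , v , refl , refl ← ∈-insertEverywhere⁻ τ σ∈′ = begin
  length (u ++ suc n ∷ v)   ≡⟨ length-++ u ⟩
  length u ℕ.+ suc (length v) ≡⟨ ℕₚ.+-suc (length u) (length v) ⟩
  suc (length u ℕ.+ length v) ≡⟨ cong suc (trans (sym (length-++ u)) (Perms-length n τ∈)) ⟩
  suc n                     ∎
  where open ≡-Reasoning

-- Commutative semirings containing ½, and their dual numbers

record SemiringWithHalf : Set₁ where
  infixl 6 _+_
  infixl 7 _*_
  field
    Carrier               : Set
    _+_ _*_               : Op₂ Carrier
    0# 1# ½               : Carrier
    isCommutativeSemiring : IsCommutativeSemiring _≡_ _+_ _*_ 0# 1#
    ½+½≡1                 : ½ + ½ ≡ 1#

module Arithmetic (S : SemiringWithHalf) where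

  commutativeSemiring : CommutativeSemiring 0ℓ 0ℓ
  commutativeSemiring = record { isCommutativeSemiring = SemiringWithHalf.isCommutativeSemiring S }

  open SemiringWithHalf S public using (½; ½+½≡1)
  open CommutativeSemiring commutativeSemiring public
    using (Carrier; _+_; _*_; 0#; 1#; +-assoc; +-comm; +-identityˡ; +-identityʳ; *-assoc; *-comm;
           *-identityˡ; *-identityʳ; zeroˡ; zeroʳ; distribˡ; distribʳ; +-isCommutativeMonoid; +-commutativeMonoid;
           rawSemiring; semiring)
  open import Algebra.Solver.Ring.NaturalCoefficients.Default commutativeSemiring public
    using (solve; _:+_; _:*_; _:=_)
  open import Algebra.Definitions.RawSemiring rawSemiring public using (_^_) renaming (_×_ to _·_)
  open import Algebra.Properties.CommutativeMonoid.Mult +-commutativeMonoid public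
    using () renaming (×-distrib-+ to ·-distrib-+)
  open import Algebra.Properties.Semiring.Mult semiring public
    using () renaming (×-homo-+ to ·-homo-+; ×-comm-* to ·-comm-*; ×-assoc-* to ·-assoc-*)
  open import Data.List.Relation.Binary.Permutation.Setoid.Properties (setoid Carrier)
    using (foldr-commMonoid)

  *½+*½ : ∀ a → a * ½ + a * ½ ≡ a
  *½+*½ a = trans (sym (distribˡ a ½ ½)) (trans (cong (a *_) ½+½≡1) (*-identityʳ a))

  ends-and-middle : ∀ a u b → a + (u + b) ≡ (a + b) + u
  ends-and-middle = solve 3 (λ a u b → a :+ (u :+ b) := (a :+ b) :+ u) refl

  ∑ : List Carrier → Carrier
  ∑ = foldr _+_ 0#

  ∑-++ : ∀ us vs → ∑ (us ++ vs) ≡ ∑ us + ∑ vs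
  ∑-++ []       vs = sym (+-identityˡ _)
  ∑-++ (u ∷ us) vs = trans (cong (u +_) (∑-++ us vs)) (sym (+-assoc _ _ _))

  ∑-↭ : ∀ {us vs} → us ↭ vs → ∑ us ≡ ∑ vs
  ∑-↭ p = foldr-commMonoid +-isCommutativeMonoid (↭⇒↭ₛ p)

  ∑-replicate : ∀ k u → ∑ (replicate k u) ≡ k · u
  ∑-replicate zero    u = refl
  ∑-replicate (suc k) u = cong (u +_) (∑-replicate k u)

  ∑-map-levels : ∀ (g : ℕ → Carrier) k A B → ∑ (map g (levels k A B)) ≡ A · g k + B · g (suc k)
  ∑-map-levels g k A B = begin
    ∑ (map g (replicate A k ++ replicate B (suc k)))            ≡⟨ cong ∑ (map-++ g (replicate A k) _) ⟩
    ∑ (map g (replicate A k) ++ map g (replicate B (suc k)))    ≡⟨ ∑-++ (map g (replicate A k)) _ ⟩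
    ∑ (map g (replicate A k)) + ∑ (map g (replicate B (suc k))) ≡⟨ cong₂ _+_ (cong ∑ (map-replicate g A k))
                                                                        (cong ∑ (map-replicate g B (suc k))) ⟩
    ∑ (replicate A (g k)) + ∑ (replicate B (g (suc k)))         ≡⟨ cong₂ _+_ (∑-replicate A _) (∑-replicate B _) ⟩
    A · g k + B · g (suc k)                                     ∎
    where open ≡-Reasoning

  ∑-concatMap : ∀ {A B : Set} (f : B → Carrier) (g : A → List B) xs →
                ∑ (map f (concatMap g xs)) ≡ ∑ (map (∑ ∘ map f ∘ g) xs)
  ∑-concatMap f g []       = refl
  ∑-concatMap f g (x ∷ xs) = begin
    ∑ (map f (g x ++ concatMap g xs))            ≡⟨ cong ∑ (map-++ f (g x) _) ⟩
    ∑ (map f (g x) ++ map f (concatMap g xs))    ≡⟨ ∑-++ (map f (g x)) _ ⟩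
    ∑ (map f (g x)) + ∑ (map f (concatMap g xs)) ≡⟨ cong (_ +_) (∑-concatMap f g xs) ⟩
    ∑ (map (∑ ∘ map f ∘ g) (x ∷ xs))             ∎
    where open ≡-Reasoning

  ∑-cong-∈ : ∀ {A : Set} {f g : A → Carrier} xs → (∀ {x} → x ∈ xs → f x ≡ g x) →
             ∑ (map f xs) ≡ ∑ (map g xs)
  ∑-cong-∈ []       eq = refl
  ∑-cong-∈ (x ∷ xs) eq = cong₂ _+_ (eq (here refl)) (∑-cong-∈ xs (eq ∘ there))

  ∑-linear : ∀ {A : Set} a b (f g : A → Carrier) xs →
             ∑ (map (λ x → a * f x + b * g x) xs) ≡ a * ∑ (map f xs) + b * ∑ (map g xs)
  ∑-linear a b f g []       = sym (trans (cong₂ _+_ (zeroʳ a) (zeroʳ b)) (+-identityˡ 0#))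
  ∑-linear a b f g (x ∷ xs) =
    trans (cong (_ +_) (∑-linear a b f g xs)) (expand a b (f x) (g x) (∑ (map f xs)) (∑ (map g xs)))
    where
    expand : ∀ a b u v U V → (a * u + b * v) + (a * U + b * V) ≡ a * (u + U) + b * (v + V)
    expand = solve 6 (λ a b u v U V → (a :* u :+ b :* v) :+ (a :* U :+ b :* V)
                                    := a :* (u :+ U) :+ b :* (v :+ V)) refl

module InsertionSums (S : SemiringWithHalf) where

  open Arithmetic S

  ∑-insertEverywhere : ∀ {m} (st : List ℕ → ℕ) (F : ℕ → ℕ → ℕ → Carrier) c cs → Below m (c ∷ cs) →
    let l = LRmin (c ∷ cs) ; r = RLmin (c ∷ cs) in
    ∑ (map (λ τ → F (st τ) (LRmin τ) (RLmin τ)) (insertEverywhere m (c ∷ cs)))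
    ≡ F (st (m ∷ c ∷ cs)) (suc l) r
      + (∑ (map (λ k → F k l r) (map (λ t → st (c ∷ t)) (insertBefore m cs)))
         + F (st ((c ∷ cs) ∷ʳ m)) l (suc r))
  ∑-insertEverywhere {m} st F c cs below = begin
    V (m ∷ c ∷ cs) + ∑ (map V (map (c ∷_) (insertEverywhere m cs)))
      ≡⟨ cong (λ ws → V (m ∷ c ∷ cs) + ∑ (map V (map (c ∷_) ws))) (insertEverywhere-split m cs) ⟩
    V (m ∷ c ∷ cs) + ∑ (map V (map (c ∷_) (I ++ (cs ∷ʳ m) ∷ [])))
      ≡⟨ cong (λ ws → V (m ∷ c ∷ cs) + ∑ ws) (trans (sym (map-∘ (I ++ _))) (map-++ (V ∘ (c ∷_)) I _)) ⟩
    V (m ∷ c ∷ cs) + ∑ (map (V ∘ (c ∷_)) I ++ V ((c ∷ cs) ∷ʳ m) ∷ [])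
      ≡⟨ cong (V (m ∷ c ∷ cs) +_) (trans (∑-++ (map (V ∘ (c ∷_)) I) _)
                                         (cong (∑ (map (V ∘ (c ∷_)) I) +_) (+-identityʳ _))) ⟩
    V (m ∷ c ∷ cs) + (∑ (map (V ∘ (c ∷_)) I) + V ((c ∷ cs) ∷ʳ m))
      ≡⟨ cong₂ _+_ front (cong₂ _+_ middle back) ⟩
    F (st (m ∷ c ∷ cs)) (suc l) r
      + (∑ (map (λ k → F k l r) (map (λ t → st (c ∷ t)) I)) + F (st ((c ∷ cs) ∷ʳ m)) l (suc r)) ∎
    where
    open ≡-Reasoning
    V : List ℕ → Carrier
    V τ = F (st τ) (LRmin τ) (RLmin τ)
    I : List (List ℕ)
    I = insertBefore m cs
    l r : ℕ
    l = LRmin (c ∷ cs)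
    r = RLmin (c ∷ cs)
    front : V (m ∷ c ∷ cs) ≡ F (st (m ∷ c ∷ cs)) (suc l) r
    front = cong₂ (F (st (m ∷ c ∷ cs))) (LRmin-max-∷ (c ∷ cs) below) (RLmin-max-∷ (c ∷ cs) (λ ()) below)
    back : V ((c ∷ cs) ∷ʳ m) ≡ F (st ((c ∷ cs) ∷ʳ m)) l (suc r)
    back = cong₂ (F (st ((c ∷ cs) ∷ʳ m))) (LRmin-∷ʳ-max (c ∷ cs) (λ ()) below) (RLmin-∷ʳ-max (c ∷ cs) below)
    middle : ∑ (map (V ∘ (c ∷_)) I) ≡ ∑ (map (λ k → F k l r) (map (λ t → st (c ∷ t)) I))
    middle = trans (∑-cong-∈ I λ {t} t∈ → let eL , eR = interior-minima c cs below t∈ in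
                                          cong₂ (F (st (c ∷ t))) eL eR)
                   (cong ∑ (map-∘ I))

  ∑-insertEverywhere-des : ∀ {m} (F : ℕ → ℕ → ℕ → Carrier) c cs → Below m (c ∷ cs) →
    let d = des (c ∷ cs) ; l = LRmin (c ∷ cs) ; r = RLmin (c ∷ cs) in
    ∃[ B ] d ℕ.+ B ≡ length cs ×
      ∑ (map (λ τ → F (des τ) (LRmin τ) (RLmin τ)) (insertEverywhere m (c ∷ cs)))
      ≡ F (suc d) (suc l) r + ((d · F d l r + B · F (suc d) l r) + F d l (suc r))
  ∑-insertEverywhere-des F c cs below with B , eB , perm ← des-insertBefore c cs below =
    B , eB , trans (∑-insertEverywhere des F c cs below)
      (cong₂ _+_ (cong (λ k → F k (suc l) r) (des-max-∷ cs (All.head below)))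
                 (cong₂ _+_ (trans (∑-↭ (map⁺ g perm)) (∑-map-levels g d d B))
                            (cong (λ k → F k l (suc r)) (des-∷ʳ-max (c ∷ cs) below))))
    where
    d l r : ℕ
    d = des (c ∷ cs)
    l = LRmin (c ∷ cs)
    r = RLmin (c ∷ cs)
    g : ℕ → Carrier
    g k = F k l r

  ∑-insertEverywhere-peaks : ∀ {m} (F : ℕ → ℕ → ℕ → Carrier) c cs → Below m (c ∷ cs) →
    let p = peaks (c ∷ cs) ; l = LRmin (c ∷ cs) ; r = RLmin (c ∷ cs) in
    ∃[ B ] 2 ℕ.* p ℕ.+ B ≡ length cs ×
      ∑ (map (λ τ → F (peaks τ) (LRmin τ) (RLmin τ)) (insertEverywhere m (c ∷ cs)))
      ≡ F p (suc l) r + (((2 ℕ.* p) · F p l r + B · F (suc p) l r) + F p l (suc r))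
  ∑-insertEverywhere-peaks F c cs below with B , eB , perm ← peaks-interior c cs below =
    B , eB , trans (∑-insertEverywhere peaks F c cs below)
      (cong₂ _+_ (cong (λ k → F k (suc l) r) (peaks-max-∷ cs (All.head below)))
                 (cong₂ _+_ (trans (∑-↭ (map⁺ g perm)) (∑-map-levels g p (2 ℕ.* p) B))
                            (cong (λ k → F k l (suc r)) (peaks-∷ʳ-max (c ∷ cs) below))))
    where
    p l r : ℕ
    p = peaks (c ∷ cs)
    l = LRmin (c ∷ cs)
    r = RLmin (c ∷ cs)
    g : ℕ → Carrier
    g k = F k l r

module DualNumbers (S : SemiringWithHalf) where

  open Arithmetic S
  infixl 6 _⊕_
  infixl 7 _⊛_

  _⊕_ _⊛_ : Op₂ (Carrier × Carrier)
  u ⊕ v = proj₁ u + proj₁ v , proj₂ u + proj₂ v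
  u ⊛ v = proj₁ u * proj₁ v , proj₁ u * proj₂ v + proj₂ u * proj₁ v

  private
    semigroup : (_∙_ : Op₂ (Carrier × Carrier)) → Associative _≡_ _∙_ → IsSemigroup _≡_ _∙_
    semigroup _∙_ assoc = record
      { isMagma = record { isEquivalence = isEquivalence ; ∙-cong = cong₂ _∙_ } ; assoc = assoc }

    *-assoc′ : ∀ a a′ b b′ c c′ →
               a * b * c′ + (a * b′ + a′ * b) * c ≡ a * (b * c′ + b′ * c) + a′ * (b * c)
    *-assoc′ = solve 6 (λ a a′ b b′ c c′ → a :* b :* c′ :+ (a :* b′ :+ a′ :* b) :* c
                                        := a :* (b :* c′ :+ b′ :* c) :+ a′ :* (b :* c)) refl

    *-identityˡ′ : ∀ a a′ → 1# * a′ + 0# * a ≡ a′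
    *-identityˡ′ a a′ = trans (cong₂ _+_ (*-identityˡ a′) (zeroˡ a)) (+-identityʳ a′)

    *-comm′ : ∀ a a′ b b′ → a * b′ + a′ * b ≡ b * a′ + b′ * a
    *-comm′ = solve 4 (λ a a′ b b′ → a :* b′ :+ a′ :* b := b :* a′ :+ b′ :* a) refl

    distribʳ′ : ∀ a a′ b b′ c c′ →
                (b + c) * a′ + (b′ + c′) * a ≡ (b * a′ + b′ * a) + (c * a′ + c′ * a)
    distribʳ′ = solve 6 (λ a a′ b b′ c c′ → (b :+ c) :* a′ :+ (b′ :+ c′) :* a
                                         := (b :* a′ :+ b′ :* a) :+ (c :* a′ :+ c′ :* a)) refl

    zeroˡ′ : ∀ a a′ → 0# * a′ + 0# * a ≡ 0#
    zeroˡ′ a a′ = trans (cong₂ _+_ (zeroˡ a′) (zeroˡ a)) (+-identityʳ 0#)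

  -- a + a′ε with ε² = 0 is the pair (a , a′).
  dual : SemiringWithHalf
  dual = record
    { Carrier               = Carrier × Carrier
    ; _+_                   = _⊕_
    ; _*_                   = _⊛_
    ; 0#                    = 0# , 0#
    ; 1#                    = 1# , 0#
    ; ½                     = ½ , 0#
    ; isCommutativeSemiring = IsCommutativeSemiringˡ.isCommutativeSemiring (record
      { +-isCommutativeMonoid = isCommutativeMonoidˡ (record
        { isSemigroup = semigroup _⊕_ λ (a , a′) (b , b′) (c , c′) →
                          cong₂ _,_ (+-assoc a b c) (+-assoc a′ b′ c′)
        ; identityˡ   = λ (a , a′) → cong₂ _,_ (+-identityˡ a) (+-identityˡ a′)
        ; comm        = λ (a , a′) (b , b′) → cong₂ _,_ (+-comm a b) (+-comm a′ b′)
        })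
      ; *-isCommutativeMonoid = isCommutativeMonoidˡ (record
        { isSemigroup = semigroup _⊛_ λ (a , a′) (b , b′) (c , c′) →
                          cong₂ _,_ (*-assoc a b c) (*-assoc′ a a′ b b′ c c′)
        ; identityˡ   = λ (a , a′) → cong₂ _,_ (*-identityˡ a) (*-identityˡ′ a a′)
        ; comm        = λ (a , a′) (b , b′) → cong₂ _,_ (*-comm a b) (*-comm′ a a′ b b′)
        })
      ; distribʳ = λ (a , a′) (b , b′) (c , c′) → cong₂ _,_ (distribʳ a b c) (distribʳ′ a a′ b b′ c c′)
      ; zeroˡ    = λ (a , a′) → cong₂ _,_ (zeroˡ a) (zeroˡ′ a a′)
      })
    ; ½+½≡1 = cong₂ _,_ ½+½≡1 (+-identityˡ 0#)
    }

  module D = Arithmetic dual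

  ι : Carrier → Carrier × Carrier
  ι a = a , 0#

  infix 9 _+ε
  _+ε : Carrier → Carrier × Carrier
  a +ε = a , 1#

  ι-+ : ∀ a b → ι a ⊕ ι b ≡ ι (a + b)
  ι-+ a b = cong (a + b ,_) (+-identityˡ 0#)

  ι-* : ∀ a b → ι a ⊛ ι b ≡ ι (a * b)
  ι-* a b = cong (a * b ,_) (trans (cong₂ _+_ (zeroʳ a) (zeroˡ b)) (+-identityˡ 0#))

  ι-^ : ∀ a k → ι a D.^ k ≡ ι (a ^ k)
  ι-^ a zero    = refl
  ι-^ a (suc k) = trans (cong (ι a ⊛_) (ι-^ a k)) (ι-* a (a ^ k))

  +ε-* : ∀ x y → x +ε ⊛ y +ε ≡ (x * y , x + y)
  +ε-* x y = cong (x * y ,_) (cong₂ _+_ (*-identityʳ x) (*-identityˡ y))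

  +ε-mean : ∀ x y → (x +ε ⊕ y +ε) ⊛ ι ½ ≡ ((x + y) * ½) +ε
  +ε-mean x y = cong ((x + y) * ½ ,_) (begin
    (x + y) * 0# + (1# + 1#) * ½ ≡⟨ cong₂ _+_ (zeroʳ (x + y)) (distribʳ ½ 1# 1#) ⟩
    0# + (1# * ½ + 1# * ½)       ≡⟨ +-identityˡ _ ⟩
    1# * ½ + 1# * ½              ≡⟨ cong₂ _+_ (*-identityˡ ½) (*-identityˡ ½) ⟩
    ½ + ½                        ≡⟨ ½+½≡1 ⟩
    1#                           ∎)
    where open ≡-Reasoning

  ι-mean : ∀ α β → (ι α ⊕ ι β) ⊛ ι ½ ≡ ι ((α + β) * ½)
  ι-mean α β = trans (cong (_⊛ ι ½) (ι-+ α β)) (ι-* (α + β) ½)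

  proj₁-^ : ∀ u k → proj₁ (u D.^ k) ≡ proj₁ u ^ k
  proj₁-^ u zero    = refl
  proj₁-^ u (suc k) = cong (proj₁ u *_) (proj₁-^ u k)

  proj₁-*-proj₂-^ : ∀ u k → proj₁ u * proj₂ (u D.^ k) ≡ k · (proj₁ u ^ k * proj₂ u)
  proj₁-*-proj₂-^ u        zero    = zeroʳ (proj₁ u)
  proj₁-*-proj₂-^ (a , a′) (suc k) = begin
    a * (a * s + a′ * proj₁ ((a , a′) D.^ k))  ≡⟨ cong (λ v → a * (a * s + a′ * v)) (proj₁-^ (a , a′) k) ⟩
    a * (a * s + a′ * a ^ k)                   ≡⟨ distribˡ a _ _ ⟩
    a * (a * s) + a * (a′ * a ^ k)             ≡⟨ cong₂ _+_ (cong (a *_) (proj₁-*-proj₂-^ (a , a′) k))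
                                                            (swap a a′ (a ^ k)) ⟩
    a * (k · (a ^ k * a′)) + a ^ suc k * a′    ≡⟨ cong (_+ a ^ suc k * a′)
                                                       (trans (·-comm-* k a _) (cong (k ·_) (sym (*-assoc a _ a′)))) ⟩
    k · (a ^ suc k * a′) + a ^ suc k * a′      ≡⟨ +-comm _ _ ⟩
    suc k · (a ^ suc k * a′)                   ∎
    where
    open ≡-Reasoning
    s : Carrier
    s = proj₂ ((a , a′) D.^ k)
    swap : ∀ a a′ b → a * (a′ * b) ≡ a * b * a′
    swap = solve 3 (λ a a′ b → a :* (a′ :* b) := a :* b :* a′) refl

  proj₂-^-suc : ∀ u k → proj₂ (u D.^ suc k) ≡ suc k · (proj₁ u ^ k * proj₂ u)
  proj₂-^-suc (a , a′) k = begin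
    a * proj₂ ((a , a′) D.^ k) + a′ * proj₁ ((a , a′) D.^ k)
      ≡⟨ cong₂ _+_ (proj₁-*-proj₂-^ (a , a′) k)
                   (trans (cong (a′ *_) (proj₁-^ (a , a′) k)) (*-comm a′ (a ^ k))) ⟩
    k · (a ^ k * a′) + a ^ k * a′
      ≡⟨ +-comm _ _ ⟩
    suc k · (a ^ k * a′) ∎
    where open ≡-Reasoning

  proj₂-⊛-ι : ∀ u a → proj₂ (u ⊛ ι a) ≡ proj₂ u * a
  proj₂-⊛-ι u a = trans (cong (_+ _) (zeroʳ (proj₁ u))) (+-identityˡ _)

  proj₂-∑ : ∀ us → proj₂ (D.∑ us) ≡ ∑ (map proj₂ us)
  proj₂-∑ []       = refl
  proj₂-∑ (u ∷ us) = cong (proj₂ u +_) (proj₂-∑ us)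

-- The two sides and their common recurrence

module Sides (S : SemiringWithHalf) where

  open Arithmetic S

  peakMonomial : (x y α β : Carrier) (p e i j : ℕ) → Carrier
  peakMonomial x y α β p e i j = (x * y) ^ p * (((x + y) * ½) ^ e * (α ^ i * β ^ j))

  descentMonomial : (x y α β : Carrier) (d e k : ℕ) → Carrier
  descentMonomial x y α β d e k = x ^ d * (y ^ e * ((α + β) * ½) ^ k)

  peakTerm : ℕ → (x y α β : Carrier) (p l r : ℕ) → Carrier
  peakTerm n x y α β p l r = peakMonomial x y α β p (n ∸ 2 ℕ.* p ∸ 1) (l ∸ 1) (r ∸ 1)

  descentTerm : ℕ → (x y α β : Carrier) (d l r : ℕ) → Carrier
  descentTerm n x y α β d l r = descentMonomial x y α β d (n ∸ d ∸ 1) (l ℕ.+ r ∸ 2)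

  peakSide descentSide : ℕ → (x y α β : Carrier) → Carrier
  peakSide n x y α β    = ∑ (map (λ σ → peakTerm n x y α β (peaks σ) (LRmin σ) (RLmin σ)) (Perms n))
  descentSide n x y α β = ∑ (map (λ σ → descentTerm n x y α β (des σ) (LRmin σ) (RLmin σ)) (Perms n))

module MonomialRecurrences (S : SemiringWithHalf) where

  open Arithmetic S
  open DualNumbers S
  open Sides S
  module Dˢ = Sides dual

  peakMonomial-ends : ∀ x y α β p e i j →
    peakMonomial x y α β p (suc e) (suc i) j + peakMonomial x y α β p (suc e) i (suc j)
    ≡ (x + y) * ((α + β) * ½) * peakMonomial x y α β p e i j
  peakMonomial-ends x y α β p e i j =
    lemma x y α β ½ ((x * y) ^ p) (((x + y) * ½) ^ e) (α ^ i) (β ^ j)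
    where
    lemma : ∀ x y α β h P C a b →
            P * ((x + y) * h * C * (α * a * b)) + P * ((x + y) * h * C * (a * (β * b)))
            ≡ (x + y) * ((α + β) * h) * (P * (C * (a * b)))
    lemma = solve 9 (λ x y α β h P C a b →
      P :* ((x :+ y) :* h :* C :* (α :* a :* b)) :+ P :* ((x :+ y) :* h :* C :* (a :* (β :* b)))
      := (x :+ y) :* ((α :+ β) :* h) :* (P :* (C :* (a :* b)))) refl

  descentMonomial-ends : ∀ x y α β d e k →
    descentMonomial x y α β (suc d) e (suc k) + descentMonomial x y α β d (suc e) (suc k)
    ≡ (x + y) * ((α + β) * ½) * descentMonomial x y α β d e k
  descentMonomial-ends x y α β d e k =
    lemma x y ((α + β) * ½) (x ^ d) (y ^ e) (((α + β) * ½) ^ k)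
    where
    lemma : ∀ x y s X Y T → x * X * (Y * (s * T)) + X * (y * Y * (s * T)) ≡ (x + y) * s * (X * (Y * T))
    lemma = solve 6 (λ x y s X Y T → x :* X :* (Y :* (s :* T)) :+ X :* (y :* Y :* (s :* T))
                                    := (x :+ y) :* s :* (X :* (Y :* T))) refl

  proj₂-descentMonomial : ∀ x y α β d e k → let T = ((α + β) * ½) ^ k in
    proj₂ (Dˢ.descentMonomial (x +ε) (y +ε) (ι α) (ι β) d e k)
    ≡ x ^ d * (proj₂ ((y +ε) D.^ e) * T) + proj₂ ((x +ε) D.^ d) * (y ^ e * T)
  proj₂-descentMonomial x y α β d e k = begin
    proj₂ (X̃ ⊛ (Ỹ ⊛ ((ι α ⊕ ι β) ⊛ ι ½) D.^ k))
      ≡⟨ cong (λ t → proj₂ (X̃ ⊛ (Ỹ ⊛ t))) (trans (cong (D._^ k) (ι-mean α β)) (ι-^ _ k)) ⟩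
    proj₁ X̃ * proj₂ (Ỹ ⊛ ι T) + proj₂ X̃ * (proj₁ Ỹ * T)
      ≡⟨ cong₂ (λ u v → u * proj₂ (Ỹ ⊛ ι T) + proj₂ X̃ * (v * T))
               (proj₁-^ (x +ε) d) (proj₁-^ (y +ε) e) ⟩
    x ^ d * proj₂ (Ỹ ⊛ ι T) + proj₂ X̃ * (y ^ e * T)
      ≡⟨ cong (λ w → x ^ d * w + proj₂ X̃ * (y ^ e * T)) (proj₂-⊛-ι Ỹ T) ⟩
    x ^ d * (proj₂ Ỹ * T) + proj₂ X̃ * (y ^ e * T) ∎
    where
    open ≡-Reasoning
    X̃ Ỹ : Carrier × Carrier
    X̃ = (x +ε) D.^ d
    Ỹ = (y +ε) D.^ e
    T : Carrier
    T = ((α + β) * ½) ^ k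

  descentMonomial-derivative : ∀ x y α β d e k →
    x * y * proj₂ (Dˢ.descentMonomial (x +ε) (y +ε) (ι α) (ι β) d e k)
    ≡ d · descentMonomial x y α β d (suc e) k + e · descentMonomial x y α β (suc d) e k
  descentMonomial-derivative x y α β d e k = begin
    x * y * proj₂ (Dˢ.descentMonomial (x +ε) (y +ε) (ι α) (ι β) d e k)
      ≡⟨ cong (x * y *_) (proj₂-descentMonomial x y α β d e k) ⟩
    x * y * (X * (proj₂ Ỹ * T) + proj₂ X̃ * (Y * T))
      ≡⟨ rearrange x y X Y T (proj₂ X̃) (proj₂ Ỹ) ⟩
    x * proj₂ X̃ * (y * Y * T) + x * X * (y * proj₂ Ỹ * T)
      ≡⟨ cong₂ (λ u v → u * (y * Y * T) + x * X * (v * T)) (scaled-derivative x d) (scaled-derivative y e) ⟩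
    d · X * (y * Y * T) + x * X * (e · Y * T)
      ≡⟨ cong₂ _+_ (·-assoc-* d X _)
                   (trans (cong (x * X *_) (·-assoc-* e Y T)) (·-comm-* e (x * X) (Y * T))) ⟩
    d · (X * (y * Y * T)) + e · (x * X * (Y * T)) ∎
    where
    open ≡-Reasoning
    X̃ Ỹ : Carrier × Carrier
    X̃ = (x +ε) D.^ d
    Ỹ = (y +ε) D.^ e
    X Y T : Carrier
    X = x ^ d
    Y = y ^ e
    T = ((α + β) * ½) ^ k
    scaled-derivative : ∀ z n → z * proj₂ ((z +ε) D.^ n) ≡ n · z ^ n
    scaled-derivative z n = trans (proj₁-*-proj₂-^ (z +ε) n) (cong (n ·_) (*-identityʳ (z ^ n)))
    rearrange : ∀ x y X Y T sX sY →
                x * y * (X * (sY * T) + sX * (Y * T)) ≡ x * sX * (y * Y * T) + x * X * (y * sY * T)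
    rearrange = solve 7 (λ x y X Y T sX sY →
      x :* y :* (X :* (sY :* T) :+ sX :* (Y :* T)) := x :* sX :* (y :* Y :* T) :+ x :* X :* (y :* sY :* T)) refl

  proj₂-peakMonomial : ∀ x y α β p e i j → let c = (x + y) * ½ ; A = α ^ i * β ^ j in
    proj₂ (Dˢ.peakMonomial (x +ε) (y +ε) (ι α) (ι β) p e i j)
    ≡ (x * y) ^ p * (proj₂ ((c +ε) D.^ e) * A) + proj₂ ((x * y , x + y) D.^ p) * (c ^ e * A)
  proj₂-peakMonomial x y α β p e i j = begin
    proj₂ (((x +ε) ⊛ (y +ε)) D.^ p ⊛ (((x +ε ⊕ y +ε) ⊛ ι ½) D.^ e ⊛ (ι α D.^ i ⊛ ι β D.^ j)))
      ≡⟨ cong₂ (λ u v → proj₂ (u ⊛ v)) (cong (D._^ p) (+ε-* x y))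
               (cong₂ _⊛_ (cong (D._^ e) (+ε-mean x y)) (trans (cong₂ _⊛_ (ι-^ α i) (ι-^ β j)) (ι-* _ _))) ⟩
    proj₁ P̃ * proj₂ (C̃ ⊛ ι A) + proj₂ P̃ * (proj₁ C̃ * A)
      ≡⟨ cong₂ (λ u v → u * proj₂ (C̃ ⊛ ι A) + proj₂ P̃ * (v * A))
               (proj₁-^ (x * y , x + y) p) (proj₁-^ (c +ε) e) ⟩
    (x * y) ^ p * proj₂ (C̃ ⊛ ι A) + proj₂ P̃ * (c ^ e * A)
      ≡⟨ cong (λ w → (x * y) ^ p * w + proj₂ P̃ * (c ^ e * A)) (proj₂-⊛-ι C̃ A) ⟩
    (x * y) ^ p * (proj₂ C̃ * A) + proj₂ P̃ * (c ^ e * A) ∎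
    where
    open ≡-Reasoning
    c A : Carrier
    c = (x + y) * ½
    A = α ^ i * β ^ j
    P̃ C̃ : Carrier × Carrier
    P̃ = (x * y , x + y) D.^ p
    C̃ = (c +ε) D.^ e

  -- At e = 0 the truncated exponent e ∸ 1 is harmless, its coefficient being 0.
  peakMonomial-derivative : ∀ x y α β p e i j →
    x * y * proj₂ (Dˢ.peakMonomial (x +ε) (y +ε) (ι α) (ι β) p e i j)
    ≡ (2 ℕ.* p) · peakMonomial x y α β p (suc e) i j + e · peakMonomial x y α β (suc p) (e ∸ 1) i j
  peakMonomial-derivative x y α β p e i j = begin
    x * y * proj₂ (Dˢ.peakMonomial (x +ε) (y +ε) (ι α) (ι β) p e i j)
      ≡⟨ cong (x * y *_) (proj₂-peakMonomial x y α β p e i j) ⟩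
    x * y * (P * (proj₂ C̃ * A) + proj₂ P̃ * (C * A))
      ≡⟨ rearrange x y P A C (proj₂ C̃) (proj₂ P̃) ⟩
    x * y * proj₂ P̃ * (C * A) + x * y * P * (proj₂ C̃ * A)
      ≡⟨ cong₂ _+_ (trans (cong (_* (C * A)) (proj₁-*-proj₂-^ (x * y , x + y) p)) peaks-kept) (peak-created e) ⟩
    (2 ℕ.* p) · (P * (c * C * A)) + e · (x * y * P * (c ^ (e ∸ 1) * A)) ∎
    where
    open ≡-Reasoning
    c P C A : Carrier
    c = (x + y) * ½
    P = (x * y) ^ p
    C = c ^ e
    A = α ^ i * β ^ j
    P̃ C̃ : Carrier × Carrier
    P̃ = (x * y , x + y) D.^ p
    C̃ = (c +ε) D.^ e
    rearrange : ∀ x y P A C sC sP →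
                x * y * (P * (sC * A) + sP * (C * A)) ≡ x * y * sP * (C * A) + x * y * P * (sC * A)
    rearrange = solve 7 (λ x y P A C sC sP →
      x :* y :* (P :* (sC :* A) :+ sP :* (C :* A)) := x :* y :* sP :* (C :* A) :+ x :* y :* P :* (sC :* A)) refl
    doubled : P * (x + y) * (C * A) ≡ P * (c * C * A) + P * (c * C * A)
    doubled = trans (cong (λ u → P * u * (C * A)) (sym (*½+*½ (x + y)))) (lemma P c C A)
      where
      lemma : ∀ P c C A → P * (c + c) * (C * A) ≡ P * (c * C * A) + P * (c * C * A)
      lemma = solve 4 (λ P c C A → P :* (c :+ c) :* (C :* A) := P :* (c :* C :* A) :+ P :* (c :* C :* A)) refl
    peaks-kept : p · (P * (x + y)) * (C * A) ≡ (2 ℕ.* p) · (P * (c * C * A))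
    peaks-kept = begin
      p · (P * (x + y)) * (C * A)    ≡⟨ ·-assoc-* p _ _ ⟩
      p · (P * (x + y) * (C * A))    ≡⟨ cong (p ·_) doubled ⟩
      p · (V + V)                    ≡⟨ ·-distrib-+ V V p ⟩
      p · V + p · V                  ≡⟨ ·-homo-+ V p p ⟨
      (p ℕ.+ p) · V                  ≡⟨ cong (λ q → (p ℕ.+ q) · V) (ℕₚ.+-identityʳ p) ⟨
      (2 ℕ.* p) · V                  ∎
      where
      V : Carrier
      V = P * (c * C * A)
    peak-created : ∀ e → x * y * P * (proj₂ ((c +ε) D.^ e) * A) ≡ e · (x * y * P * (c ^ (e ∸ 1) * A))
    peak-created zero     = trans (cong (x * y * P *_) (zeroˡ A)) (zeroʳ _)
    peak-created (suc e′) = begin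
      x * y * P * (proj₂ ((c +ε) D.^ suc e′) * A)
        ≡⟨ cong (λ u → x * y * P * (u * A)) (proj₂-^-suc (c +ε) e′) ⟩
      x * y * P * (suc e′ · (c ^ e′ * 1#) * A)
        ≡⟨ cong (λ u → x * y * P * (suc e′ · u * A)) (*-identityʳ _) ⟩
      x * y * P * (suc e′ · c ^ e′ * A)
        ≡⟨ cong (x * y * P *_) (·-assoc-* (suc e′) _ A) ⟩
      x * y * P * (suc e′ · (c ^ e′ * A))
        ≡⟨ ·-comm-* (suc e′) _ _ ⟩
      suc e′ · (x * y * P * (c ^ e′ * A)) ∎

  descentMonomial-recurrence : ∀ x y α β d e k →
    descentMonomial x y α β (suc d) e (suc k)
      + ((d · descentMonomial x y α β d (suc e) k + e · descentMonomial x y α β (suc d) e k)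
         + descentMonomial x y α β d (suc e) (suc k))
    ≡ (x + y) * ((α + β) * ½) * descentMonomial x y α β d e k
      + x * y * proj₂ (Dˢ.descentMonomial (x +ε) (y +ε) (ι α) (ι β) d e k)
  descentMonomial-recurrence x y α β d e k = trans (ends-and-middle _ _ _)
    (cong₂ _+_ (descentMonomial-ends x y α β d e k) (sym (descentMonomial-derivative x y α β d e k)))

  peakMonomial-recurrence : ∀ x y α β p e i j →
    peakMonomial x y α β p (suc e) (suc i) j
      + (((2 ℕ.* p) · peakMonomial x y α β p (suc e) i j + e · peakMonomial x y α β (suc p) (e ∸ 1) i j)
         + peakMonomial x y α β p (suc e) i (suc j))
    ≡ (x + y) * ((α + β) * ½) * peakMonomial x y α β p e i j
      + x * y * proj₂ (Dˢ.peakMonomial (x +ε) (y +ε) (ι α) (ι β) p e i j)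
  peakMonomial-recurrence x y α β p e i j = trans (ends-and-middle _ _ _)
    (cong₂ _+_ (peakMonomial-ends x y α β p e i j) (sym (peakMonomial-derivative x y α β p e i j)))

module Recurrence (S : SemiringWithHalf) where

  open Arithmetic S
  open DualNumbers S
  open Sides S
  open InsertionSums S
  open MonomialRecurrences S

  private
    size-∸ : ∀ d B → suc (d ℕ.+ B) ∸ d ∸ 1 ≡ B
    size-∸ zero    B = refl
    size-∸ (suc d) B = size-∸ d B

    size-∸-suc : ∀ d B → suc (suc (d ℕ.+ B)) ∸ d ∸ 1 ≡ suc B
    size-∸-suc zero    B = refl
    size-∸-suc (suc d) B = size-∸-suc d B

    minima-∸ : ∀ l r → l ℕ.+ suc r ∸ 1 ≡ l ℕ.+ r
    minima-∸ l r = cong (_∸ 1) (ℕₚ.+-suc l r)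

  descentTerm-recurrence : ∀ x y α β d B l r → 0 < l → 0 < r →
    let n = suc (d ℕ.+ B) ; T = descentTerm (suc n) x y α β in
    T (suc d) (suc l) r + ((d · T d l r + B · T (suc d) l r) + T d l (suc r))
    ≡ (x + y) * ((α + β) * ½) * descentTerm n x y α β d l r
      + x * y * proj₂ (Dˢ.descentTerm n (x +ε) (y +ε) (ι α) (ι β) d l r)
  descentTerm-recurrence x y α β d B (suc l) (suc r) _ _ = begin
    M (suc d) (suc (d ℕ.+ B) ∸ d ∸ 1) (l ℕ.+ suc r)
      + ((d · M d (suc (suc (d ℕ.+ B)) ∸ d ∸ 1) (l ℕ.+ suc r ∸ 1)
          + B · M (suc d) (suc (d ℕ.+ B) ∸ d ∸ 1) (l ℕ.+ suc r ∸ 1))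
         + M d (suc (suc (d ℕ.+ B)) ∸ d ∸ 1) (l ℕ.+ suc (suc r) ∸ 1))
      ≡⟨ cong₂ _+_ (M≡ (suc d) (size-∸ d B) (ℕₚ.+-suc l r))
                   (cong₂ _+_ (cong₂ _+_ (cong (d ·_) (M≡ d (size-∸-suc d B) (minima-∸ l r)))
                                         (cong (B ·_) (M≡ (suc d) (size-∸ d B) (minima-∸ l r))))
                              (M≡ d (size-∸-suc d B) (trans (minima-∸ l (suc r)) (ℕₚ.+-suc l r)))) ⟩
    M (suc d) B (suc k) + ((d · M d (suc B) k + B · M (suc d) B k) + M d (suc B) (suc k))
      ≡⟨ descentMonomial-recurrence x y α β d B k ⟩
    (x + y) * ((α + β) * ½) * M d B k + x * y * proj₂ (Dˢ.descentMonomial (x +ε) (y +ε) (ι α) (ι β) d B k)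
      ≡⟨ sym (cong₂ (λ e k → (x + y) * ((α + β) * ½) * M d e k
                             + x * y * proj₂ (Dˢ.descentMonomial (x +ε) (y +ε) (ι α) (ι β) d e k))
                    (size-∸ d B) (minima-∸ l r)) ⟩
    (x + y) * ((α + β) * ½) * descentTerm (suc (d ℕ.+ B)) x y α β d (suc l) (suc r)
      + x * y * proj₂ (Dˢ.descentTerm (suc (d ℕ.+ B)) (x +ε) (y +ε) (ι α) (ι β) d (suc l) (suc r)) ∎
    where
    open ≡-Reasoning
    k : ℕ
    k = l ℕ.+ r
    M : ℕ → ℕ → ℕ → Carrier
    M = descentMonomial x y α β
    M≡ : ∀ d {e e′ k k′} → e ≡ e′ → k ≡ k′ → M d e k ≡ M d e′ k′
    M≡ d = cong₂ (M d)

  peakTerm-recurrence : ∀ x y α β p B l r → 0 < l → 0 < r →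
    let n = suc (2 ℕ.* p ℕ.+ B) ; T = peakTerm (suc n) x y α β in
    T p (suc l) r + (((2 ℕ.* p) · T p l r + B · T (suc p) l r) + T p l (suc r))
    ≡ (x + y) * ((α + β) * ½) * peakTerm n x y α β p l r
      + x * y * proj₂ (Dˢ.peakTerm n (x +ε) (y +ε) (ι α) (ι β) p l r)
  peakTerm-recurrence x y α β p B (suc l) (suc r) _ _ = begin
    N p (suc (suc (2p ℕ.+ B)) ∸ 2p ∸ 1) (suc l) r
      + ((2p · N p (suc (suc (2p ℕ.+ B)) ∸ 2p ∸ 1) l r
          + B · N (suc p) (suc (suc (2p ℕ.+ B)) ∸ 2 ℕ.* suc p ∸ 1) l r)
         + N p (suc (suc (2p ℕ.+ B)) ∸ 2p ∸ 1) l (suc r))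
      ≡⟨ cong₂ _+_ (cong (λ e → N p e (suc l) r) (size-∸-suc 2p B))
                   (cong₂ _+_ (cong₂ _+_ (cong (λ e → 2p · N p e l r) (size-∸-suc 2p B))
                                         (cong (λ e → B · N (suc p) e l r) created))
                              (cong (λ e → N p e l (suc r)) (size-∸-suc 2p B))) ⟩
    N p (suc B) (suc l) r + ((2p · N p (suc B) l r + B · N (suc p) (B ∸ 1) l r) + N p (suc B) l (suc r))
      ≡⟨ peakMonomial-recurrence x y α β p B l r ⟩
    (x + y) * ((α + β) * ½) * N p B l r + x * y * proj₂ (Dˢ.peakMonomial (x +ε) (y +ε) (ι α) (ι β) p B l r)
      ≡⟨ sym (cong (λ e → (x + y) * ((α + β) * ½) * N p e l r
                          + x * y * proj₂ (Dˢ.peakMonomial (x +ε) (y +ε) (ι α) (ι β) p e l r))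
                   (size-∸ 2p B)) ⟩
    (x + y) * ((α + β) * ½) * peakTerm (suc (2p ℕ.+ B)) x y α β p (suc l) (suc r)
      + x * y * proj₂ (Dˢ.peakTerm (suc (2p ℕ.+ B)) (x +ε) (y +ε) (ι α) (ι β) p (suc l) (suc r)) ∎
    where
    open ≡-Reasoning
    2p : ℕ
    2p = 2 ℕ.* p
    N : ℕ → ℕ → ℕ → ℕ → Carrier
    N = peakMonomial x y α β
    created : suc (suc (2p ℕ.+ B)) ∸ 2 ℕ.* suc p ∸ 1 ≡ B ∸ 1
    created = trans (cong (λ t → suc (suc (2p ℕ.+ B)) ∸ t ∸ 1) (ℕₚ.*-suc 2 p))
                    (cong (_∸ 1) (ℕₚ.m+n∸m≡n 2p B))

  ∑-Perms-suc : ∀ n (w w₀ : List ℕ → Carrier) (w̃ : List ℕ → Carrier × Carrier) a b →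
    (∀ {σ} → σ ∈ Perms n → ∑ (map w (insertEverywhere (suc n) σ)) ≡ a * w₀ σ + b * proj₂ (w̃ σ)) →
    ∑ (map w (Perms (suc n))) ≡ a * ∑ (map w₀ (Perms n)) + b * proj₂ (D.∑ (map w̃ (Perms n)))
  ∑-Perms-suc n w w₀ w̃ a b insertions = begin
    ∑ (map w (concatMap (insertEverywhere (suc n)) (Perms n)))
      ≡⟨ ∑-concatMap w (insertEverywhere (suc n)) (Perms n) ⟩
    ∑ (map (∑ ∘ map w ∘ insertEverywhere (suc n)) (Perms n))
      ≡⟨ ∑-cong-∈ (Perms n) insertions ⟩
    ∑ (map (λ σ → a * w₀ σ + b * proj₂ (w̃ σ)) (Perms n))
      ≡⟨ ∑-linear a b w₀ (proj₂ ∘ w̃) (Perms n) ⟩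
    a * ∑ (map w₀ (Perms n)) + b * ∑ (map (proj₂ ∘ w̃) (Perms n))
      ≡⟨ cong (λ t → a * ∑ (map w₀ (Perms n)) + b * t)
              (trans (cong ∑ (map-∘ (Perms n))) (sym (proj₂-∑ (map w̃ (Perms n))))) ⟩
    a * ∑ (map w₀ (Perms n)) + b * proj₂ (D.∑ (map w̃ (Perms n))) ∎
    where open ≡-Reasoning

  descent-insertions : ∀ n x y α β {σ} → σ ∈ Perms (suc n) →
    ∑ (map (λ τ → descentTerm (suc (suc n)) x y α β (des τ) (LRmin τ) (RLmin τ)) (insertEverywhere (suc (suc n)) σ))
    ≡ (x + y) * ((α + β) * ½) * descentTerm (suc n) x y α β (des σ) (LRmin σ) (RLmin σ)
      + x * y * proj₂ (Dˢ.descentTerm (suc n) (x +ε) (y +ε) (ι α) (ι β) (des σ) (LRmin σ) (RLmin σ))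
  descent-insertions n x y α β {[]} σ∈ with () ← Perms-length (suc n) σ∈
  descent-insertions n x y α β {c ∷ cs} σ∈
    with B , eB , expansion ← ∑-insertEverywhere-des (descentTerm (suc (suc n)) x y α β) c cs (Perms-below (suc n) σ∈)
    with refl ← trans eB (ℕₚ.suc-injective (Perms-length (suc n) σ∈)) =
    trans expansion (descentTerm-recurrence x y α β (des (c ∷ cs)) B (LRmin (c ∷ cs)) (RLmin (c ∷ cs))
                                            (s≤s z≤n) (0<RLmin c cs))

  peak-insertions : ∀ n x y α β {σ} → σ ∈ Perms (suc n) →
    ∑ (map (λ τ → peakTerm (suc (suc n)) x y α β (peaks τ) (LRmin τ) (RLmin τ)) (insertEverywhere (suc (suc n)) σ))
    ≡ (x + y) * ((α + β) * ½) * peakTerm (suc n) x y α β (peaks σ) (LRmin σ) (RLmin σ)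
      + x * y * proj₂ (Dˢ.peakTerm (suc n) (x +ε) (y +ε) (ι α) (ι β) (peaks σ) (LRmin σ) (RLmin σ))
  peak-insertions n x y α β {[]} σ∈ with () ← Perms-length (suc n) σ∈
  peak-insertions n x y α β {c ∷ cs} σ∈
    with B , eB , expansion ← ∑-insertEverywhere-peaks (peakTerm (suc (suc n)) x y α β) c cs (Perms-below (suc n) σ∈)
    with refl ← trans eB (ℕₚ.suc-injective (Perms-length (suc n) σ∈)) =
    trans expansion (peakTerm-recurrence x y α β (peaks (c ∷ cs)) B (LRmin (c ∷ cs)) (RLmin (c ∷ cs))
                                         (s≤s z≤n) (0<RLmin c cs))

  descentSide-suc : ∀ n x y α β → descentSide (suc (suc n)) x y α β
    ≡ (x + y) * ((α + β) * ½) * descentSide (suc n) x y α β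
      + x * y * proj₂ (Dˢ.descentSide (suc n) (x +ε) (y +ε) (ι α) (ι β))
  descentSide-suc n x y α β = ∑-Perms-suc (suc n) _ _ _ _ _ (descent-insertions n x y α β)

  peakSide-suc : ∀ n x y α β → peakSide (suc (suc n)) x y α β
    ≡ (x + y) * ((α + β) * ½) * peakSide (suc n) x y α β
      + x * y * proj₂ (Dˢ.peakSide (suc n) (x +ε) (y +ε) (ι α) (ι β))
  peakSide-suc n x y α β = ∑-Perms-suc (suc n) _ _ _ _ _ (peak-insertions n x y α β)

peakSide≡descentSide : ∀ n (S : SemiringWithHalf) (x y α β : SemiringWithHalf.Carrier S) →
              Sides.peakSide S (suc n) x y α β ≡ Sides.descentSide S (suc n) x y α β
peakSide≡descentSide zero S x y α β = cong (λ z → 1# * (1# * z) + 0#) (*-identityʳ 1#)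
  where open Arithmetic S
peakSide≡descentSide (suc n) S x y α β = begin
  peakSide (suc (suc n)) x y α β
    ≡⟨ peakSide-suc n x y α β ⟩
  (x + y) * ((α + β) * ½) * peakSide (suc n) x y α β
    + x * y * proj₂ (Dˢ.peakSide (suc n) (x +ε) (y +ε) (ι α) (ι β))
    ≡⟨ cong₂ (λ u v → (x + y) * ((α + β) * ½) * u + x * y * proj₂ v)
             (peakSide≡descentSide n S x y α β) (peakSide≡descentSide n dual (x +ε) (y +ε) (ι α) (ι β)) ⟩
  (x + y) * ((α + β) * ½) * descentSide (suc n) x y α β
    + x * y * proj₂ (Dˢ.descentSide (suc n) (x +ε) (y +ε) (ι α) (ι β))
    ≡⟨ descentSide-suc n x y α β ⟨
  descentSide (suc (suc n)) x y α β ∎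
  where
  open ≡-Reasoning
  open Arithmetic S
  open DualNumbers S
  open Sides S
  open Recurrence S
  module Dˢ = Sides dual

-- Rational numbers

open import Data.Nat using (_≥_)
import Data.Nat
open import Data.Rational using (ℚ; ½; _+_; _*_; 0ℚ; 1ℚ)
import Data.Rational.Properties as ℚₚ
open import Defs using (sumℚ; _^_)

ℚ-semiringWithHalf : SemiringWithHalf
ℚ-semiringWithHalf = record
  { Carrier               = ℚ
  ; _+_                   = _+_
  ; _*_                   = _*_
  ; 0#                    = 0ℚ
  ; 1#                    = 1ℚ
  ; ½                     = ½
  ; isCommutativeSemiring = IsCommutativeRing.isCommutativeSemiring ℚₚ.+-*-isCommutativeRing
  ; ½+½≡1                 = refl
  }

open Arithmetic ℚ-semiringWithHalf using () renaming (_^_ to _^ℚ_)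

^-agrees : ∀ q k → q ^ k ≡ q ^ℚ k
^-agrees q zero    = refl
^-agrees q (suc k) = cong (q *_) (^-agrees q k)

peakTerm-ℚ : ∀ n (x y α β : ℚ) p l r →
  (x * y) ^ p * (((x + y) * ½) ^ (n ∸ 2 Data.Nat.* p ∸ 1) * (α ^ (l ∸ 1) * β ^ (r ∸ 1)))
  ≡ Sides.peakTerm ℚ-semiringWithHalf n x y α β p l r
peakTerm-ℚ n x y α β p l r =
  cong₂ _*_ (^-agrees (x * y) p)
    (cong₂ _*_ (^-agrees ((x + y) * ½) (n ∸ 2 Data.Nat.* p ∸ 1))
               (cong₂ _*_ (^-agrees α (l ∸ 1)) (^-agrees β (r ∸ 1))))

descentTerm-ℚ : ∀ n (x y α β : ℚ) d l r →
  x ^ d * (y ^ (n ∸ d ∸ 1) * ((α + β) * ½) ^ (l Data.Nat.+ r ∸ 2))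
  ≡ Sides.descentTerm ℚ-semiringWithHalf n x y α β d l r
descentTerm-ℚ n x y α β d l r =
  cong₂ _*_ (^-agrees x d)
    (cong₂ _*_ (^-agrees y (n ∸ d ∸ 1)) (^-agrees ((α + β) * ½) (l Data.Nat.+ r ∸ 2)))

mainTheorem6 : (n : ℕ) → n ≥ 1 → (x y α β : ℚ) →
    sumℚ (map (λ σ → ((x * y) ^ peaks σ) * ((((x + y) * ½) ^ (n ∸ 2 Data.Nat.* peaks σ ∸ 1)) * ((α ^ (LRmin σ ∸ 1)) * (β ^ (RLmin σ ∸ 1))))) (Perms n))
      ≡ sumℚ (map (λ σ → (x ^ des σ) * ((y ^ (n ∸ des σ ∸ 1)) * (((α + β) * ½) ^ (LRmin σ Data.Nat.+ RLmin σ ∸ 2)))) (Perms n))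
mainTheorem6 (suc n) _ x y α β =
  trans (cong sumℚ (map-cong (λ σ → peakTerm-ℚ (suc n) x y α β (peaks σ) (LRmin σ) (RLmin σ)) Sₙ))
    (trans (peakSide≡descentSide n ℚ-semiringWithHalf x y α β)
      (sym (cong sumℚ (map-cong (λ σ → descentTerm-ℚ (suc n) x y α β (des σ) (LRmin σ) (RLmin σ)) Sₙ))))
  where
  Sₙ : List (List ℕ)
  Sₙ = Perms (suc n)
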